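{- Let $G$ be a 2-connected graph with a normal spanning tree $T$, and suppose the vertices of $G$ are numbered with a numbering compatible with $T$. Let $a,b\in V(G)$ be such that $a$ is a proper ancestor of $b$ and $b$ is not a leaf. Let $\ell$ be the left child of $b$, and suppose there is no edge of $G$ between $Desc(\ell)$ and $T(a,b)$. Let $\alpha=\alpha(b)$ and $\beta=\beta(b)$. Then there exists a type-2 separation of $G$ with separator $\{a'<b'\}$ such that $a<a'<b<\ell\le b'$ in the tree order if and only if $\alpha>a$, every child $c$ of $\beta$ satisfies $lwpt(c)\ge\alpha$ or $hgpt(c)\le\alpha$, and $T[\alpha,\beta]$ is stable.
   Context: "$x<y$ in the tree order" means $x$ is a proper ancestor of $y$ in $T$, and "$x\le y$" means $x$ is an ancestor of $y$. A separation is a pair $(A,B)$ with $A\cup B=V(G)$, $A\setminus B,B\setminus A\ne\emptyset$, no edge between them. $T$ rooted at $r$; $p(v)$ parent; $T[u,v]$ tree path, $T(u,v)$ without endpoints; $Desc(v)$ descendants (including $v$), $ND(v)=|Desc(v)|$; normal: endpoints of each edge comparable; back-edges $(x,y)$, $x$ a descendant of $y$. $L(v)$: proper ancestors of $v$ adjacent to a vertex of $Desc(v)$; $lwpt_k(v)$: $k$-th element of $L(v)$ closest to the root if $|L(v)|\ge k$, else $v$; $lwpt=lwpt_1$; $hgpt(v)$: element of $L(v)\setminus\{p(v)\}$ farthest from the root if nonempty, else $v$. Vertices are $[n]$; compatible numbering: descendants of each $j$ form $[j,j+ND(j)-1]$ and siblings $j<k$ satisfy $(-lwpt_1(j),lwpt_2(j))\le_{lex}(-lwpt_1(k),lwpt_2(k))$.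 Left child = largest child; leftmost descendant = reached by repeatedly taking left children (zero or more times); $T[a,b]$ is a leftmost path if $b$ is a leftmost descendant of a child $a'$ of $a$; for $a<b$ it is stable if every back-edge $(x,y)$ with $a'\le x<b$ (numerically) has $y\ge a$; non-leftmost paths are not stable. For $a\le b$ with $T[a,b]$ leftmost, $stab(a,b)$ is the largest ancestor $\alpha'$ of $a$ with $T[\alpha',b]$ stable, or $0$. For $b\ne r$ not a leaf with left child $\ell$: $\alpha(b)=stab(p(b),\ell)$ and $\beta(b)$ is the minimum leftmost descendant $\beta$ of $\ell$ that is a leaf or whose left child $\ell'$ satisfies $lwpt(\ell')\ge b$ or $hgpt(\ell')<b$; if $b=r$ or $b$ a leaf, $\alpha(b)=\beta(b)=0$. A 2-separation with separator $\{a,b\}$ is type-2 if $r\notin\{a,b\}$, $V(T(a,b))\ne\emptyset$ and up to exchanging sides $r\in A\setminus B$, $V(T(a,b))\subseteq B\setminus A$; otherwise type-1. -}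

module Defs where

open import Data.Nat using (ℕ; zero; suc; _+_; _≤_; _<_)
open import Data.Bool using (Bool; true; false)
open import Data.Product using (Σ; _×_; _,_)
open import Data.Sum using (_⊎_)
open import Relation.Nullary using (¬_)
open import Relation.Binary.PropositionalEquality using (_≡_; _≢_)
open import Function.Bundles using (_⇔_)

iter : (ℕ → ℕ) → ℕ → ℕ → ℕ
iter f zero    x = x
iter f (suc k) x = f (iter f k x)

-- The data of the setting: a graph G on the vertex set [n] = {1,…,n}
-- given by a (Boolean) adjacency function, and a rooted tree T given by
-- its root and parent function.
record Frame : Set where
  field
    n      : ℕ
    adj    : ℕ → ℕ → Bool
    root   : ℕ
    parent : ℕ → ℕ

module _ (F : Frame) where
  open Frame F

  V : ℕ → Set
  V v = 1 ≤ v × v ≤ n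

  Edge : ℕ → ℕ → Set
  Edge x y = adj x y ≡ true

  SimpleGraph : Set
  SimpleGraph = (∀ x y → Edge x y → Edge y x)
              × (∀ x → ¬ Edge x x)
              × (∀ x y → Edge x y → V x × V y)

  -- walks in G − z from x to w (z = 0 is not a vertex, so AvoidPath 0 = walks in G)
  data AvoidPath (z : ℕ) : ℕ → ℕ → Set where
    here : ∀ {x} → V x → x ≢ z → AvoidPath z x x
    step : ∀ {x y w} → x ≢ z → Edge x y → AvoidPath z y w → AvoidPath z x w

  TwoConnected : Set
  TwoConnected = 3 ≤ n
               × (∀ x y → V x → V y → AvoidPath 0 x y)
               × (∀ z x y → V z → V x → V y → x ≢ z → y ≢ z → AvoidPath z x y)

  -- x ≤ y in the tree order: x is an ancestor of y (y itself included)
  Anc : ℕ → ℕ → Set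
  Anc x y = V y × Σ ℕ (λ k → iter parent k y ≡ x)

  PAnc : ℕ → ℕ → Set
  PAnc x y = Anc x y × x ≢ y

  RootedSpanningTree : Set
  RootedSpanningTree = V root
                     × parent root ≡ root
                     × (∀ v → V v → v ≢ root → Edge v (parent v))
                     × (∀ v → V v → Σ ℕ (λ k → iter parent k v ≡ root))

  Normal : Set
  Normal = ∀ x y → Edge x y → Anc x y ⊎ Anc y x

  Child : ℕ → ℕ → Set
  Child c v = V c × c ≢ root × parent c ≡ v

  Leaf : ℕ → Set
  Leaf v = ∀ c → ¬ Child c v

  InL : ℕ → ℕ → Set
  InL v u = PAnc u v × Σ ℕ (λ x → Anc v x × Edge x u)

  MinOrSelf : (ℕ → Set) → ℕ → ℕ → Set
  MinOrSelf S v w = (S w × (∀ u → S u → Anc w u)) ⊎ ((∀ u → ¬ S u) × w ≡ v)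

  MaxOrSelf : (ℕ → Set) → ℕ → ℕ → Set
  MaxOrSelf S v w = (S w × (∀ u → S u → Anc u w)) ⊎ ((∀ u → ¬ S u) × w ≡ v)

  Lwpt1 : ℕ → ℕ → Set
  Lwpt1 v w = MinOrSelf (InL v) v w

  Lwpt2 : ℕ → ℕ → Set
  Lwpt2 v w = Σ ℕ (λ w1 → Lwpt1 v w1 × MinOrSelf (λ u → InL v u × u ≢ w1) v w)

  Hgpt : ℕ → ℕ → Set
  Hgpt v w = MaxOrSelf (λ u → InL v u × u ≢ parent v) v w

  Compatible : Set
  Compatible =
      (∀ j → V j → Σ ℕ (λ m → ∀ v → (Anc j v ⇔ (j ≤ v × v < j + m))))
    × (∀ j k → V j → V k → j ≢ root → k ≢ root → parent j ≡ parent k → j < k →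
        ∀ l1j l2j l1k l2k → Lwpt1 j l1j → Lwpt2 j l2j → Lwpt1 k l1k → Lwpt2 k l2k →
        (l1k < l1j) ⊎ (l1j ≡ l1k × l2j ≤ l2k))

  -- l is the left child (largest child) of b
  LeftChild : ℕ → ℕ → Set
  LeftChild b l = Child l b × (∀ c → Child c b → c ≤ l)

  data LeftmostDesc (a : ℕ) : ℕ → Set where
    lm-refl : LeftmostDesc a a
    lm-step : ∀ {c d} → LeftmostDesc a c → LeftChild c d → LeftmostDesc a d

  BackEdge : ℕ → ℕ → Set
  BackEdge x y = Edge x y × PAnc y x

  LeftmostPath : ℕ → ℕ → Set
  LeftmostPath a b = Σ ℕ (λ a' → Child a' a × LeftmostDesc a' b)

  Stable : ℕ → ℕ → Set
  Stable a b = Σ ℕ (λ a' → Child a' a × LeftmostDesc a' b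
                 × (∀ x y → BackEdge x y → a' ≤ x → x < b → a ≤ y))

  IsStab : ℕ → ℕ → ℕ → Set
  IsStab a b s = (Anc s a × Stable s b × (∀ s' → Anc s' a → Stable s' b → s' ≤ s))
               ⊎ ((∀ s' → Anc s' a → ¬ Stable s' b) × s ≡ 0)

  IsAlpha : ℕ → ℕ → Set
  IsAlpha b s = ((b ≡ root ⊎ Leaf b) × s ≡ 0)
              ⊎ (b ≢ root × Σ ℕ (λ l → LeftChild b l × IsStab (parent b) l s))

  BetaCond : ℕ → ℕ → Set
  BetaCond b β' = Leaf β'
                ⊎ Σ ℕ (λ l' → LeftChild β' l' × Σ ℕ (λ w → Σ ℕ (λ h →
                    Lwpt1 l' w × Hgpt l' h × (b ≤ w ⊎ h < b))))

  IsBeta : ℕ → ℕ → Set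
  IsBeta b t = ((b ≡ root ⊎ Leaf b) × t ≡ 0)
             ⊎ (b ≢ root × Σ ℕ (λ l → LeftChild b l × LeftmostDesc l t × BetaCond b t
                 × (∀ t' → LeftmostDesc l t' → BetaCond b t' → t ≤ t')))

  -- (A, B) is a separation of G (A, B ⊆ [n] given by characteristic functions)
  Separation : (ℕ → Bool) → (ℕ → Bool) → Set
  Separation A B =
      (∀ v → V v → A v ≡ true ⊎ B v ≡ true)
    × (∀ v → A v ≡ true → V v)
    × (∀ v → B v ≡ true → V v)
    × Σ ℕ (λ v → A v ≡ true × B v ≡ false)
    × Σ ℕ (λ v → B v ≡ true × A v ≡ false)
    × (∀ x y → A x ≡ true → B x ≡ false → B y ≡ true → A y ≡ false → ¬ Edge x y)

  Separator : (ℕ → Bool) → (ℕ → Bool) → ℕ → ℕ → Set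
  Separator A B x y = x ≢ y × (∀ v → (A v ≡ true × B v ≡ true) ⇔ (v ≡ x ⊎ v ≡ y))

  OnPath : ℕ → ℕ → ℕ → Set
  OnPath x y v = (Anc v x ⊎ Anc v y) × (∀ w → Anc w x → Anc w y → Anc w v)

  Interior : ℕ → ℕ → ℕ → Set
  Interior x y v = OnPath x y v × v ≢ x × v ≢ y

  Type2 : (ℕ → Bool) → (ℕ → Bool) → ℕ → ℕ → Set
  Type2 A B x y =
      Separation A B × Separator A B x y
    × x ≢ root × y ≢ root
    × Σ ℕ (λ v → Interior x y v)
    × ((A root ≡ true × B root ≡ false × (∀ v → Interior x y v → B v ≡ true × A v ≡ false))
      ⊎ (B root ≡ true × A root ≡ false × (∀ v → Interior x y v → A v ≡ true × B v ≡ false)))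

-- Forward direction: orient the separation {a′, b′} so that the root lies on the A side. Proper
-- ancestors of a′ are then on the A side, while the child a″ of a′ towards b′ and all of
-- Desc(a″) ∖ Desc(b′) are on the B side. Since G − a′ is connected, some edge joins Desc(b′) to a
-- proper ancestor of a′, and the compatible numbering turns this into T[a″, b′] being a leftmost
-- path. The B side then makes T[a′, ℓ] stable, so a < a′ ≤ α, and b′ satisfies the condition
-- defining β, so β ≤ b′; stability of T[α, β] and the condition on the children of β follow.
-- Backward direction: with α″ the child of α on T[α, β], put on the B side Desc(α″) ∖ Desc(β)
-- together with the subtrees of those children of β that have an edge strictly between α and β;
-- stability of T[α, β] and the condition on the children of β leave no edge out of this set
-- except through α and β.
module Submission where

open import Defs
open import Data.Nat using (ℕ; zero; suc; _+_; _∸_; _≤_; _<_; z≤n; s≤s; _≟_; _≤?_; _<?_)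
open import Data.Nat.Properties
open import Data.Nat.Induction using (<-rec)
open import Data.Bool using (Bool; true; false)
open import Data.Product using (Σ; ∃; _×_; _,_; proj₁; proj₂)
open import Data.Sum using (_⊎_; inj₁; inj₂; [_,_]′; map; map₂)
open import Data.Empty using (⊥; ⊥-elim)
open import Function using (_∘_)
open import Function.Bundles using (_⇔_; mk⇔; Equivalence)
open import Relation.Binary.PropositionalEquality
open import Relation.Nullary using (¬_; Dec; yes; no; does; contradiction)
open import Relation.Nullary.Decidable using (map′; toSum; _×-dec_; _⊎-dec_; ¬?; dec-true; dec-false; decidable-stable)
open import Relation.Unary using (Decidable)

does-true⇒ : ∀ {P : Set} (P? : Dec P) → does P? ≡ true → P
does-true⇒ (yes p) _ = p

does-false⇒ : ∀ {P : Set} (P? : Dec P) → does P? ≡ false → ¬ P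
does-false⇒ (no ¬p) _ = ¬p

Least Greatest : (ℕ → Set) → ℕ → Set
Least    P x = P x × (∀ y → P y → x ≤ y)
Greatest P x = P x × (∀ y → P y → y ≤ x)

module _ {P : ℕ → Set} (P? : Decidable P) where

  bounded-∃? : ∀ n → (∀ x → P x → x ≤ n) → Dec (∃ P)
  bounded-∃? n bound = map′ (λ (x , _ , px) → x , px) (λ (x , px) → x , s≤s (bound x px) , px)
                            (anyUpTo? P? (suc n))

  least : ∀ {m} → P m → ∃ (Least P)
  least {m} = <-rec (λ m → P m → ∃ (Least P)) descend m
    where
    descend : ∀ m → (∀ {k} → k < m → P k → ∃ (Least P)) → P m → ∃ (Least P)
    descend m below pm with anyUpTo? P? m
    ... | yes (k , k<m , pk) = below k<m pk
    ... | no none = m , pm , λ y py → ≮⇒≥ λ y<m → none (y , y<m , py)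

  greatest : ∀ n → (∀ x → P x → x ≤ n) → ∀ {m} → P m → ∃ (Greatest P)
  greatest n bound pm with P? n
  ... | yes pn = n , pn , bound
  greatest zero bound {m} pm | no ¬p0 with bound m pm
  ... | z≤n = contradiction pm ¬p0
  greatest (suc n) bound pm | no ¬pn = greatest n bound′ pm
    where
    bound′ : ∀ x → P x → x ≤ n
    bound′ x px = ≤-pred (≤∧≢⇒< (bound x px) λ { refl → ¬pn px })

module _ (F : Frame) where
  open Frame F

  V? : Decidable (V F)
  V? v = 1 ≤? v ×-dec v ≤? n

  Edge? : ∀ x y → Dec (Edge F x y)
  Edge? x y = adj x y Data.Bool.≟ true

module TreeOrder (F : Frame) (sg : SimpleGraph F) (rst : RootedSpanningTree F) (cmp : Compatible F) where
  open Frame F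

  V-root : V F root
  V-root = proj₁ rst

  parent-root : parent root ≡ root
  parent-root = proj₁ (proj₂ rst)

  tree-edge : ∀ {v} → V F v → v ≢ root → Edge F v (parent v)
  tree-edge {v} = proj₁ (proj₂ (proj₂ rst)) v

  reaches-root : ∀ {v} → V F v → Σ ℕ λ k → iter parent k v ≡ root
  reaches-root {v} = proj₂ (proj₂ (proj₂ rst)) v

  edge-sym : ∀ {x y} → Edge F x y → Edge F y x
  edge-sym {x} {y} = proj₁ sg x y

  edge-V : ∀ {x y} → Edge F x y → V F x × V F y
  edge-V {x} {y} = proj₂ (proj₂ sg) x y

  iter-parent-comm : ∀ k x → iter parent k (parent x) ≡ parent (iter parent k x)
  iter-parent-comm zero    x = refl
  iter-parent-comm (suc k) x = cong parent (iter-parent-comm k x)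

  iter-+ : ∀ k m x → iter parent (k + m) x ≡ iter parent k (iter parent m x)
  iter-+ zero    m x = refl
  iter-+ (suc k) m x = cong parent (iter-+ k m x)

  iter-fixed : ∀ {x} → parent x ≡ x → ∀ k → iter parent k x ≡ x
  iter-fixed e zero    = refl
  iter-fixed e (suc k) = trans (cong parent (iter-fixed e k)) e

  V-parent : ∀ {v} → V F v → V F (parent v)
  V-parent {v} vv with v ≟ root
  ... | yes refl = subst (V F) (sym parent-root) V-root
  ... | no v≢r   = proj₂ (edge-V (tree-edge vv v≢r))

  V-iter : ∀ {v} k → V F v → V F (iter parent k v)
  V-iter zero    vv = vv
  V-iter (suc k) vv = V-parent (V-iter k vv)

  anc-Vˡ : ∀ {x y} → Anc F x y → V F x
  anc-Vˡ (vy , k , e) = subst (V F) e (V-iter k vy)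

  anc-Vʳ : ∀ {x y} → Anc F x y → V F y
  anc-Vʳ = proj₁

  anc-refl : ∀ {x} → V F x → Anc F x x
  anc-refl vx = vx , 0 , refl

  anc-trans : ∀ {x y z} → Anc F x y → Anc F y z → Anc F x z
  anc-trans (_ , m , e₁) (vz , k , e₂) = vz , m + k , trans (iter-+ m k _) (trans (cong (iter parent m) e₂) e₁)

  anc-parent : ∀ {v} → V F v → Anc F (parent v) v
  anc-parent vv = vv , 1 , refl

  anc-root : ∀ {v} → V F v → Anc F root v
  anc-root vv = vv , reaches-root vv

  anc⇔interval : ∀ {j} → V F j → Σ ℕ λ m → ∀ v → Anc F j v ⇔ (j ≤ v × v < j + m)
  anc⇔interval {j} = proj₁ cmp j

  anc⇒≤ : ∀ {x y} → Anc F x y → x ≤ y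
  anc⇒≤ {y = y} x≼y = proj₁ (Equivalence.to (proj₂ (anc⇔interval (anc-Vˡ x≼y)) y) x≼y)

  anc-antisym : ∀ {x y} → Anc F x y → Anc F y x → x ≡ y
  anc-antisym x≼y y≼x = ≤-antisym (anc⇒≤ x≼y) (anc⇒≤ y≼x)

  Anc? : ∀ x y → Dec (Anc F x y)
  Anc? x y with V? F x
  ... | no ¬vx = no λ x≼y → ¬vx (anc-Vˡ x≼y)
  ... | yes vx with anc⇔interval vx
  ... | m , iff = map′ (Equivalence.from (iff y)) (Equivalence.to (iff y)) (x ≤? y ×-dec y <? x + m)

  iter-∸ : ∀ {v k m x y} → k ≤ m → iter parent k v ≡ x → iter parent m v ≡ y → iter parent (m ∸ k) x ≡ y
  iter-∸ {v} {k} {m} k≤m refl refl = begin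
    iter parent (m ∸ k) (iter parent k v)   ≡⟨ iter-+ (m ∸ k) k v ⟨
    iter parent (m ∸ k + k) v               ≡⟨ cong (λ i → iter parent i v) (m∸n+n≡m k≤m) ⟩
    iter parent m v                         ∎
    where open ≡-Reasoning

  anc-comparable : ∀ {x y v} → Anc F x v → Anc F y v → Anc F x y ⊎ Anc F y x
  anc-comparable (vv , k , e₁) (_ , m , e₂) with ≤-total k m
  ... | inj₁ k≤m = inj₂ (anc-Vˡ (vv , k , e₁) , m ∸ k , iter-∸ k≤m e₁ e₂)
  ... | inj₂ m≤k = inj₁ (anc-Vˡ (vv , m , e₂) , k ∸ m , iter-∸ m≤k e₂ e₁)

  parent-< : ∀ {v} → V F v → v ≢ root → parent v < v
  parent-< {v} vv v≢r = ≤∧≢⇒< (anc⇒≤ (anc-parent vv)) parent≢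
    where
    parent≢ : parent v ≢ v
    parent≢ fixed = let k , e = reaches-root vv in v≢r (trans (sym (iter-fixed fixed k)) e)

  anc-root⇒root : ∀ {x} → Anc F x root → x ≡ root
  anc-root⇒root x≼r = anc-antisym x≼r (anc-root (anc-Vˡ x≼r))

  panc⇒< : ∀ {x y} → PAnc F x y → x < y
  panc⇒< (x≼y , x≢y) = ≤∧≢⇒< (anc⇒≤ x≼y) x≢y

  panc⇒anc-parent : ∀ {x v} → PAnc F x v → Anc F x (parent v)
  panc⇒anc-parent ((_ , zero , e) , x≢v) = ⊥-elim (x≢v (sym e))
  panc⇒anc-parent {v = v} ((vv , suc k , e) , _) = V-parent vv , k , trans (iter-parent-comm k v) e

  panc⇒≢root : ∀ {x y} → PAnc F x y → y ≢ root
  panc⇒≢root x≺y refl = <⇒≱ (panc⇒< x≺y) (anc⇒≤ (anc-root (anc-Vˡ (proj₁ x≺y))))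

  panc⇒child : ∀ {x z} → PAnc F x z → Child F z (parent z)
  panc⇒child x≺z = anc-Vʳ (proj₁ x≺z) , panc⇒≢root x≺z , refl

  child⇒anc : ∀ {c u} → Child F c u → Anc F u c
  child⇒anc (vc , _ , refl) = anc-parent vc

  child⇒< : ∀ {c u} → Child F c u → u < c
  child⇒< (vc , c≢r , refl) = parent-< vc c≢r

  child⇒panc : ∀ {c u} → Child F c u → PAnc F u c
  child⇒panc ch = child⇒anc ch , <⇒≢ (child⇒< ch)

  anc-child⇒anc-parent : ∀ {c u y} → Child F c u → Anc F y c → y ≢ c → Anc F y u
  anc-child⇒anc-parent (_ , _ , refl) y≼c y≢c = panc⇒anc-parent (y≼c , y≢c)

  child-towards : ∀ {x v} → Anc F x v → x ≢ v → Σ ℕ λ c → Child F c x × Anc F c v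
  child-towards {x} {v} (vv , k , e) x≢v = go k e
    where
    go : ∀ k → iter parent k v ≡ x → Σ ℕ λ c → Child F c x × Anc F c v
    go zero e = ⊥-elim (x≢v (sym e))
    go (suc k) e with iter parent k v ≟ x
    ... | yes e′ = go k e′
    ... | no c≢x = iter parent k v , (V-iter k vv , c≢root , e) , (vv , k , refl)
      where
      c≢root : iter parent k v ≢ root
      c≢root c≡r = c≢x (trans c≡r (trans (sym parent-root) (trans (cong parent (sym c≡r)) e)))

  child-towards-unique : ∀ {c c′ u x} → Child F c u → Child F c′ u → Anc F c x → Anc F c′ x → c ≡ c′
  child-towards-unique {c} {c′} ch ch′ c≼x c′≼x with c ≟ c′
  ... | yes e = e
  ... | no c≢c′ with anc-comparable c≼x c′≼x
  ... | inj₁ c≼c′ = contradiction (anc⇒≤ (anc-child⇒anc-parent ch′ c≼c′ c≢c′)) (<⇒≱ (child⇒< ch))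
  ... | inj₂ c′≼c = contradiction (anc⇒≤ (anc-child⇒anc-parent ch c′≼c (c≢c′ ∘ sym))) (<⇒≱ (child⇒< ch′))

  Child? : ∀ c u → Dec (Child F c u)
  Child? c u = V? F c ×-dec (¬? (c ≟ root) ×-dec (parent c ≟ u))

  leftChild-exists : ∀ {c u} → Child F c u → ∃ (LeftChild F u)
  leftChild-exists {u = u} = greatest (λ x → Child? x u) n (λ x chx → proj₂ (proj₁ chx))

  leftChild-unique : ∀ {u l l′} → LeftChild F u l → LeftChild F u l′ → l ≡ l′
  leftChild-unique (ch , max) (ch′ , max′) = ≤-antisym (max′ _ ch) (max _ ch′)

  between⇒interior : ∀ {x y v} → Anc F x v → Anc F v y → v ≢ x → v ≢ y → Interior F x y v
  between⇒interior x≼v v≼y v≢x v≢y = (inj₂ v≼y , λ w w≼x _ → anc-trans w≼x x≼v) , v≢x , v≢y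

  interior⇒between : ∀ {x y v} → Anc F x y → Interior F x y v → Anc F x v × Anc F v y
  interior⇒between x≼y ((inj₁ v≼x , common) , v≢x , _) =
    ⊥-elim (v≢x (anc-antisym v≼x (common _ (anc-refl (anc-Vˡ x≼y)) x≼y)))
  interior⇒between x≼y ((inj₂ v≼y , common) , _) = common _ (anc-refl (anc-Vˡ x≼y)) x≼y , v≼y

  child-on-branch⇒anc : ∀ {c x y z} → Child F c x → Anc F c z → Anc F y z → x < y → Anc F c y
  child-on-branch⇒anc {c} {y = y} ch c≼z y≼z x<y with anc-comparable c≼z y≼z
  ... | inj₁ c≼y = c≼y
  ... | inj₂ y≼c with y ≟ c
  ... | yes refl = anc-refl (proj₁ ch)
  ... | no y≢c = contradiction (anc⇒≤ (anc-child⇒anc-parent ch y≼c y≢c)) (<⇒≱ x<y)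

  leftmost⇒anc : ∀ {a d} → V F a → LeftmostDesc F a d → Anc F a d
  leftmost⇒anc va lm-refl = anc-refl va
  leftmost⇒anc va (lm-step a≼c lc) = anc-trans (leftmost⇒anc va a≼c) (child⇒anc (proj₁ lc))

  leftmost-trans : ∀ {a b c} → LeftmostDesc F a b → LeftmostDesc F b c → LeftmostDesc F a c
  leftmost-trans a≼b lm-refl = a≼b
  leftmost-trans a≼b (lm-step b≼c lc) = lm-step (leftmost-trans a≼b b≼c) lc

  -- x descends from a sibling c < l, and Desc(c) = [c, c + m) is an interval avoiding l
  leftChild-outside⇒< : ∀ {v l x} → LeftChild F v l → Anc F v x → x ≢ v → ¬ Anc F l x → x < l
  leftChild-outside⇒< {l = l} {x} (l-child , max) v≼x x≢v l⋠x with child-towards v≼x (x≢v ∘ sym)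
  ... | c , c-child , c≼x with c ≟ l
  ... | yes refl = contradiction c≼x l⋠x
  ... | no c≢l with anc⇔interval (proj₁ c-child)
  ... | m , iff = <-≤-trans (proj₂ (Equivalence.to (iff x) c≼x)) c+m≤l
    where
    c+m≤l : c + m ≤ l
    c+m≤l = ≮⇒≥ λ l<c+m → c≢l (child-towards-unique c-child l-child
              (Equivalence.from (iff l) (max c c-child , l<c+m)) (anc-refl (proj₁ l-child)))

  leftmost-outside⇒< : ∀ {a d x} → LeftmostDesc F a d → Anc F a x → ¬ Anc F d x → x < d
  leftmost-outside⇒< lm-refl a≼x d⋠x = contradiction a≼x d⋠x
  leftmost-outside⇒< {x = x} (lm-step {c} a≼c lc) a≼x d⋠x with Anc? c x
  ... | no c⋠x = <-trans (leftmost-outside⇒< a≼c a≼x c⋠x) (child⇒< (proj₁ lc))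
  ... | yes c≼x with x ≟ c
  ... | yes refl = child⇒< (proj₁ lc)
  ... | no x≢c = leftChild-outside⇒< lc c≼x x≢c d⋠x

  before-leftmost⇒outside : ∀ {a d x} → V F a → LeftmostDesc F a d → a ≤ x → x < d → Anc F a x × ¬ Anc F d x
  before-leftmost⇒outside {x = x} va a≼d a≤x x<d with anc⇔interval va
  ... | m , iff = Equivalence.from (iff x) (a≤x , <-trans x<d (proj₂ (Equivalence.to (iff _) (leftmost⇒anc va a≼d))))
                , λ d≼x → <⇒≱ x<d (anc⇒≤ d≼x)

  leftmost-≤⇒anc : ∀ {a d d′} → V F a → LeftmostDesc F a d → LeftmostDesc F a d′ → d ≤ d′ → Anc F d d′
  leftmost-≤⇒anc va a≼d a≼d′ d≤d′ with Anc? _ _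
  ... | yes d≼d′ = d≼d′
  ... | no d⋠d′ = contradiction d≤d′ (<⇒≱ (leftmost-outside⇒< a≼d (leftmost⇒anc va a≼d′) d⋠d′))

  module _ {S : ℕ → Set} (S? : Decidable S) {v : ℕ} (S⊆anc : ∀ u → S u → Anc F u v) where

    private
      bound : ∀ u → S u → u ≤ n
      bound u su = proj₂ (anc-Vˡ (S⊆anc u su))

      ≤⇒anc : ∀ {w u} → S w → S u → w ≤ u → Anc F w u
      ≤⇒anc {w} {u} sw su w≤u with anc-comparable (S⊆anc w sw) (S⊆anc u su)
      ... | inj₁ w≼u = w≼u
      ... | inj₂ u≼w = subst (λ z → Anc F z u) (≤-antisym (anc⇒≤ u≼w) w≤u) (anc-refl (anc-Vˡ u≼w))

    minOrSelf-exists : ∃ (MinOrSelf F S v)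
    minOrSelf-exists with bounded-∃? S? n bound
    ... | no none = v , inj₂ ((λ u su → none (u , su)) , refl)
    ... | yes (_ , su) with least S? su
    ... | w , sw , min = w , inj₁ (sw , λ u su → ≤⇒anc sw su (min u su))

    maxOrSelf-exists : ∃ (MaxOrSelf F S v)
    maxOrSelf-exists with bounded-∃? S? n bound
    ... | no none = v , inj₂ ((λ u su → none (u , su)) , refl)
    ... | yes (_ , su) with greatest S? n bound su
    ... | w , sw , max = w , inj₁ (sw , λ u su → ≤⇒anc su sw (max u su))

  minOrSelf-unique : ∀ {S v w w′} → MinOrSelf F S v w → MinOrSelf F S v w′ → w ≡ w′
  minOrSelf-unique (inj₁ (sw , min)) (inj₁ (sw′ , min′)) = anc-antisym (min _ sw′) (min′ _ sw)
  minOrSelf-unique (inj₁ (sw , _))   (inj₂ (none , _))   = contradiction sw (none _)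
  minOrSelf-unique (inj₂ (none , _)) (inj₁ (sw′ , _))    = contradiction sw′ (none _)
  minOrSelf-unique (inj₂ (_ , refl)) (inj₂ (_ , refl))   = refl

  maxOrSelf-unique : ∀ {S v w w′} → MaxOrSelf F S v w → MaxOrSelf F S v w′ → w ≡ w′
  maxOrSelf-unique (inj₁ (sw , max)) (inj₁ (sw′ , max′)) = anc-antisym (max′ _ sw) (max _ sw′)
  maxOrSelf-unique (inj₁ (sw , _))   (inj₂ (none , _))   = contradiction sw (none _)
  maxOrSelf-unique (inj₂ (none , _)) (inj₁ (sw′ , _))    = contradiction sw′ (none _)
  maxOrSelf-unique (inj₂ (_ , refl)) (inj₂ (_ , refl))   = refl

  InL? : ∀ v u → Dec (InL F v u)
  InL? v u = (Anc? u v ×-dec ¬? (u ≟ v))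
       ×-dec bounded-∃? (λ x → Anc? v x ×-dec Edge? F x u) n (λ _ (v≼x , _) → proj₂ (anc-Vʳ v≼x))

  InL⇒anc : ∀ {v u} → InL F v u → Anc F u v
  InL⇒anc = proj₁ ∘ proj₁

  lwpt₁-exists : ∀ v → ∃ (Lwpt1 F v)
  lwpt₁-exists v = minOrSelf-exists (InL? v) (λ _ → InL⇒anc)

  lwpt₂-exists : ∀ v → ∃ (Lwpt2 F v)
  lwpt₂-exists v with lwpt₁-exists v
  ... | w₁ , lw₁ with minOrSelf-exists (λ u → InL? v u ×-dec ¬? (u ≟ w₁)) (λ _ → InL⇒anc ∘ proj₁)
  ... | w₂ , lw₂ = w₂ , w₁ , lw₁ , lw₂

  hgpt-exists : ∀ v → ∃ (Hgpt F v)
  hgpt-exists v = maxOrSelf-exists (λ u → InL? v u ×-dec ¬? (u ≟ parent v)) (λ _ → InL⇒anc ∘ proj₁)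


  lwpt₁-≤ : ∀ {v w u} → Lwpt1 F v w → InL F v u → w ≤ u
  lwpt₁-≤ (inj₁ (_ , min))  u∈L = anc⇒≤ (min _ u∈L)
  lwpt₁-≤ (inj₂ (none , _)) u∈L = contradiction u∈L (none _)

  hgpt-≥ : ∀ {v h u} → Hgpt F v h → InL F v u → u ≢ parent v → u ≤ h
  hgpt-≥ (inj₁ (_ , max))  u∈L u≢p = anc⇒≤ (max _ (u∈L , u≢p))
  hgpt-≥ (inj₂ (none , _)) u∈L u≢p = contradiction (u∈L , u≢p) (none _)

  sibling-lwpt₁-≤ : ∀ {u j k wj wk} → Child F j u → Child F k u → j < k → Lwpt1 F j wj → Lwpt1 F k wk → wk ≤ wj
  sibling-lwpt₁-≤ {j = j} {k} (vj , j≢r , refl) (vk , k≢r , k-sib) j<k lj lk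
    with proj₂ cmp j k vj vk j≢r k≢r (sym k-sib) j<k _ _ _ _
               lj (proj₂ (lwpt₂-exists j)) lk (proj₂ (lwpt₂-exists k))
  ... | inj₁ wk<wj     = <⇒≤ wk<wj
  ... | inj₂ (wj≡wk , _) = ≤-reflexive (sym wj≡wk)

  isAlpha⇒isStab : ∀ {b ℓ α} → b ≢ root → ¬ Leaf F b → LeftChild F b ℓ → IsAlpha F b α → IsStab F (parent b) ℓ α
  isAlpha⇒isStab b≢r _ _ (inj₁ (inj₁ b≡r , _)) = contradiction b≡r b≢r
  isAlpha⇒isStab _ inner _ (inj₁ (inj₂ leaf , _)) = contradiction leaf inner
  isAlpha⇒isStab _ _ ℓ-left (inj₂ (_ , ℓ′ , ℓ′-left , stab)) with leftChild-unique ℓ′-left ℓ-left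
  ... | refl = stab

  isBeta⇒spec : ∀ {b ℓ β} → b ≢ root → ¬ Leaf F b → LeftChild F b ℓ → IsBeta F b β
              → LeftmostDesc F ℓ β × BetaCond F b β × (∀ t′ → LeftmostDesc F ℓ t′ → BetaCond F b t′ → β ≤ t′)
  isBeta⇒spec b≢r _ _ (inj₁ (inj₁ b≡r , _)) = contradiction b≡r b≢r
  isBeta⇒spec _ inner _ (inj₁ (inj₂ leaf , _)) = contradiction leaf inner
  isBeta⇒spec _ _ ℓ-left (inj₂ (_ , ℓ′ , ℓ′-left , spec)) with leftChild-unique ℓ′-left ℓ-left
  ... | refl = spec

walk-head≢ : ∀ {F z x t} → AvoidPath F z x t → x ≢ z
walk-head≢ (here _ x≢z)   = x≢z
walk-head≢ (step x≢z _ _) = x≢z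

walk-exit : ∀ {F z x t} {P : ℕ → Set} → Decidable P → AvoidPath F z x t → P x → ¬ P t
          → Σ ℕ λ x′ → Σ ℕ λ y′ → P x′ × ¬ P y′ × Edge F x′ y′ × y′ ≢ z
walk-exit P? (here _ _) px ¬pt = contradiction px ¬pt
walk-exit P? (step {x} {y} _ e walk) px ¬pt with P? y
... | yes py = walk-exit P? walk py ¬pt
... | no ¬py = x , y , px , ¬py , e , walk-head≢ walk

record RootSide (F : Frame) (s t : ℕ) : Set where
  field
    A B        : ℕ → Bool
    cover      : ∀ v → V F v → A v ≡ true ⊎ B v ≡ true
    no-edge    : ∀ x y → A x ≡ true → B x ≡ false → B y ≡ true → A y ≡ false → ¬ Edge F x y
    A∩B⊆       : ∀ v → A v ≡ true × B v ≡ true → v ≡ s ⊎ v ≡ t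
    root-A     : A (Frame.root F) ≡ true × B (Frame.root F) ≡ false
    interior-B : ∀ v → Interior F s t v → B v ≡ true × A v ≡ false

type2⇒rootSide : ∀ {F A B s t} → SimpleGraph F → Type2 F A B s t → RootSide F s t
type2⇒rootSide {A = A} {B} _ ((cover , _ , _ , _ , _ , no-edge) , (_ , A∩B) , _ , _ , _ , inj₁ (ar , br , int)) =
  record { A = A ; B = B ; cover = cover ; no-edge = no-edge ; A∩B⊆ = λ v → Equivalence.to (A∩B v)
         ; root-A = ar , br ; interior-B = int }
type2⇒rootSide {A = A} {B} sg ((cover , _ , _ , _ , _ , no-edge) , (_ , A∩B) , _ , _ , _ , inj₂ (br , ar , int)) =
  record { A = B ; B = A ; cover = λ v vv → [ inj₂ , inj₁ ]′ (cover v vv)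
         ; no-edge = λ x y bx ax ay by e → no-edge y x ay by bx ax (proj₁ sg x y e)
         ; A∩B⊆ = λ v (bv , av) → Equivalence.to (A∩B v) (av , bv)
         ; root-A = br , ar ; interior-B = int }

module Sides {F : Frame} (sg : SimpleGraph F) (rst : RootedSpanningTree F) (cmp : Compatible F)
             {s t : ℕ} (R : RootSide F s t) where
  open Frame F
  open TreeOrder F sg rst cmp
  open RootSide R

  OnlyA OnlyB : ℕ → Set
  OnlyA v = A v ≡ true × B v ≡ false
  OnlyB v = B v ≡ true × A v ≡ false

  onlyA-onlyB-no-edge : ∀ {x y} → OnlyA x → OnlyB y → ¬ Edge F x y
  onlyA-onlyB-no-edge (ax , bx) (by , ay) = no-edge _ _ ax bx by ay

  side : ∀ {v} → V F v → v ≢ s → v ≢ t → OnlyA v ⊎ OnlyB v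
  side {v} vv v≢s v≢t with A v in eA | B v in eB
  ... | true  | false = inj₁ (refl , refl)
  ... | false | true  = inj₂ (refl , refl)
  ... | true  | true  = ⊥-elim ([ v≢s , v≢t ]′ (A∩B⊆ v (eA , eB)))
  ... | false | false with cover v vv
  ...   | inj₁ e = contradiction (trans (sym eA) e) λ ()
  ...   | inj₂ e = contradiction (trans (sym eB) e) λ ()

  onlyA-closed : ∀ {x y} → Edge F x y → x ≢ s → x ≢ t → OnlyA y → OnlyA x
  onlyA-closed e x≢s x≢t ay with side (proj₁ (edge-V e)) x≢s x≢t
  ... | inj₁ ax = ax
  ... | inj₂ bx = contradiction (edge-sym e) (onlyA-onlyB-no-edge ay bx)

  onlyB-closed : ∀ {x y} → Edge F x y → x ≢ s → x ≢ t → OnlyB y → OnlyB x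
  onlyB-closed e x≢s x≢t by with side (proj₁ (edge-V e)) x≢s x≢t
  ... | inj₁ ax = contradiction e (onlyA-onlyB-no-edge ax by)
  ... | inj₂ bx = bx

  spread-down : ∀ {S : ℕ → Set} → (∀ {x y} → Edge F x y → x ≢ s → x ≢ t → S y → S x)
              → ∀ {u} → S u → (R : ℕ → Set) → (∀ {x} → R x → x ≢ u → R (parent x))
              → (∀ {x} → R x → x ≢ s × x ≢ t) → ∀ {x} → Anc F u x → R x → S x
  spread-down {S} closed {u} su R R-up R-avoids (vx , k , e) = go k vx e
    where
    go : ∀ k {x} → V F x → iter parent k x ≡ u → R x → S x
    go zero    _ refl _ = su
    go (suc k) {x} vx e rx with x ≟ u
    ... | yes refl = su
    ... | no x≢u = closed (tree-edge vx (panc⇒≢root ((vx , suc k , e) , x≢u ∘ sym)))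
                          (proj₁ (R-avoids rx)) (proj₂ (R-avoids rx))
                          (go k (V-parent vx) (trans (iter-parent-comm k x) e) (R-up rx x≢u))

module SideSeparation {F : Frame} (V-root : V F (Frame.root F)) {S : ℕ → Set} (S? : Decidable S)
                      (S⊆V : ∀ {v} → S v → V F v) {s t : ℕ} (Vs : V F s) (Vt : V F t)
                      (s∉S : ¬ S s) (t∉S : ¬ S t) where
  open Frame F

  A? : ∀ v → Dec (V F v × ¬ S v)
  A? v = V? F v ×-dec ¬? (S? v)

  B? : ∀ v → Dec (V F v × (S v ⊎ v ≡ s ⊎ v ≡ t))
  B? v = V? F v ×-dec (S? v ⊎-dec (v ≟ s ⊎-dec v ≟ t))

  A B : ℕ → Bool
  A v = does (A? v)
  B v = does (B? v)

  private
    A-false⇒ : ∀ {v} → A v ≡ false → V F v → S v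
    A-false⇒ {v} av vv = decidable-stable (S? v) λ ¬sv → does-false⇒ (A? v) av (vv , ¬sv)

    B-false⇒ : ∀ {v} → B v ≡ false → V F v → ¬ S v × v ≢ s × v ≢ t
    B-false⇒ {v} bv vv = (λ sv → ¬B (vv , inj₁ sv)) , (λ v≡s → ¬B (vv , inj₂ (inj₁ v≡s)))
                                                   , (λ v≡t → ¬B (vv , inj₂ (inj₂ v≡t)))
      where
      ¬B : ¬ (V F v × (S v ⊎ v ≡ s ⊎ v ≡ t))
      ¬B = does-false⇒ (B? v) bv

    inside : ∀ {v} → S v → B v ≡ true × A v ≡ false
    inside {v} sv = dec-true (B? v) (S⊆V sv , inj₁ sv) , dec-false (A? v) (λ (_ , ¬sv) → ¬sv sv)

    outside : ∀ {v} → V F v → ¬ S v → v ≢ s → v ≢ t → A v ≡ true × B v ≡ false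
    outside {v} vv ¬sv v≢s v≢t =
      dec-true (A? v) (vv , ¬sv) , dec-false (B? v) λ (_ , p) → [ ¬sv , [ v≢s , v≢t ]′ ]′ p

  type2 : s ≢ t → s ≢ root → t ≢ root → ¬ S root
        → (∀ x y → ¬ S x → x ≢ s → x ≢ t → S y → ¬ Edge F x y)
        → Σ ℕ (Interior F s t) → (∀ v → Interior F s t v → S v)
        → Type2 F A B s t
  type2 s≢t s≢r t≢r ¬S-root no-edge (v₀ , int₀) interior⊆S =
    separation , (s≢t , λ v → mk⇔ (A∩B⊆ v) (⊆A∩B v)) , s≢r , t≢r , (v₀ , int₀) , inj₁ orientation
    where
    root-outside : A root ≡ true × B root ≡ false
    root-outside = outside V-root ¬S-root (s≢r ∘ sym) (t≢r ∘ sym)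

    cover : ∀ v → V F v → A v ≡ true ⊎ B v ≡ true
    cover v vv = [ inj₂ ∘ proj₁ ∘ inside , (λ ¬sv → inj₁ (dec-true (A? v) (vv , ¬sv))) ]′ (toSum (S? v))

    separated : ∀ x y → A x ≡ true → B x ≡ false → B y ≡ true → A y ≡ false → ¬ Edge F x y
    separated x y ax bx by ay with does-true⇒ (A? x) ax
    ... | vx , ¬sx with B-false⇒ bx vx
    ... | _ , x≢s , x≢t = no-edge x y ¬sx x≢s x≢t (A-false⇒ ay (proj₁ (does-true⇒ (B? y) by)))

    A∩B⊆ : ∀ v → A v ≡ true × B v ≡ true → v ≡ s ⊎ v ≡ t
    A∩B⊆ v (av , bv) with does-true⇒ (B? v) bv
    ... | _ , inj₁ sv = contradiction sv (proj₂ (does-true⇒ (A? v) av))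
    ... | _ , inj₂ v∈st = v∈st

    ⊆A∩B : ∀ v → v ≡ s ⊎ v ≡ t → A v ≡ true × B v ≡ true
    ⊆A∩B v (inj₁ refl) = dec-true (A? v) (Vs , s∉S) , dec-true (B? v) (Vs , inj₂ (inj₁ refl))
    ⊆A∩B v (inj₂ refl) = dec-true (A? v) (Vt , t∉S) , dec-true (B? v) (Vt , inj₂ (inj₂ refl))

    separation : Separation F A B
    separation = cover , (λ v → proj₁ ∘ does-true⇒ (A? v)) , (λ v → proj₁ ∘ does-true⇒ (B? v))
               , (root , root-outside) , (v₀ , inside (interior⊆S v₀ int₀)) , separated

    orientation : A root ≡ true × B root ≡ false × (∀ v → Interior F s t v → B v ≡ true × A v ≡ false)
    orientation = proj₁ root-outside , proj₂ root-outside , λ v → inside ∘ interior⊆S v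

module Setting (F : Frame) (sg : SimpleGraph F) (tc : TwoConnected F) (rst : RootedSpanningTree F)
               (normal : Normal F) (cmp : Compatible F)
               {a b : ℕ} (a≺b : PAnc F a b) (b-inner : ¬ Leaf F b) {ℓ : ℕ} (ℓ-left : LeftChild F b ℓ)
               (ℓ↛ab : ∀ x y → Anc F ℓ x → Interior F a b y → ¬ Edge F x y)
               {α β : ℕ} (α-def : IsAlpha F b α) (β-def : IsBeta F b β) where
  open Frame F
  open TreeOrder F sg rst cmp

  Type2Below : Set
  Type2Below = Σ ℕ λ a′ → Σ ℕ λ b′ → Σ (ℕ → Bool) λ A → Σ (ℕ → Bool) λ B →
                 PAnc F a a′ × PAnc F a′ b × PAnc F b ℓ × Anc F ℓ b′ × Type2 F A B a′ b′

  ChildrenCondition : Set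
  ChildrenCondition = ∀ c → Child F c β → ∀ w h → Lwpt1 F c w → Hgpt F c h → α ≤ w ⊎ h ≤ α

  a<b : a < b
  a<b = panc⇒< a≺b

  b≢root : b ≢ root
  b≢root = panc⇒≢root a≺b

  ℓ-child : Child F ℓ b
  ℓ-child = proj₁ ℓ-left

  Vℓ : V F ℓ
  Vℓ = proj₁ ℓ-child

  b≼ℓ : Anc F b ℓ
  b≼ℓ = child⇒anc ℓ-child

  b<ℓ : b < ℓ
  b<ℓ = child⇒< ℓ-child

  α-stab : IsStab F (parent b) ℓ α
  α-stab = isAlpha⇒isStab b≢root b-inner ℓ-left α-def

  β-spec : LeftmostDesc F ℓ β × BetaCond F b β × (∀ t′ → LeftmostDesc F ℓ t′ → BetaCond F b t′ → β ≤ t′)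
  β-spec = isBeta⇒spec b≢root b-inner ℓ-left β-def

  ℓ⇝β : LeftmostDesc F ℓ β
  ℓ⇝β = proj₁ β-spec

  ℓ≼β : Anc F ℓ β
  ℓ≼β = leftmost⇒anc Vℓ ℓ⇝β

  b≼β : Anc F b β
  b≼β = anc-trans b≼ℓ ℓ≼β

  b<β : b < β
  b<β = <-≤-trans b<ℓ (anc⇒≤ ℓ≼β)

  low-hgpt : ∀ {c h} → Anc F ℓ c → Hgpt F c h → h < b → h ≤ a
  low-hgpt ℓ≼c (inj₂ (_ , refl)) h<b = contradiction (<-trans h<b (<-≤-trans b<ℓ (anc⇒≤ ℓ≼c))) (<-irrefl refl)
  low-hgpt {c} {h} ℓ≼c (inj₁ ((((h≼c , _) , x , c≼x , x~h) , _) , _)) h<b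
    with anc-comparable h≼c (anc-trans b≼ℓ ℓ≼c)
  ... | inj₂ b≼h = contradiction (anc⇒≤ b≼h) (<⇒≱ h<b)
  ... | inj₁ h≼b with anc-comparable h≼b (proj₁ a≺b)
  ...   | inj₁ h≼a = anc⇒≤ h≼a
  ...   | inj₂ a≼h with h ≟ a
  ...     | yes refl = ≤-refl
  ...     | no h≢a = contradiction x~h (ℓ↛ab x h (anc-trans ℓ≼c c≼x) (between⇒interior a≼h h≼b h≢a (<⇒≢ h<b)))

  edge-leaving-subtree : ∀ {c x y} → Anc F c x → Edge F x y → y < c → Anc F y c
  edge-leaving-subtree c≼x x~y y<c with normal _ _ x~y
  ... | inj₁ x≼y = contradiction (anc⇒≤ (anc-trans c≼x x≼y)) (<⇒≱ y<c)
  ... | inj₂ y≼x with anc-comparable y≼x c≼x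
  ...   | inj₁ y≼c = y≼c
  ...   | inj₂ c≼y = contradiction (anc⇒≤ c≼y) (<⇒≱ y<c)

  module Forward {a′ b′ : ℕ} (R : RootSide F a′ b′) (a≺a′ : PAnc F a a′) (a′≺b : PAnc F a′ b)
                 (ℓ≼b′ : Anc F ℓ b′) (a′≢root : a′ ≢ root)
                 {a″ : ℕ} (a″-child : Child F a″ a′) (a″≼b′ : Anc F a″ b′) where
    open RootSide R
    open Sides sg rst cmp R

    a<a′ : a < a′
    a<a′ = panc⇒< a≺a′

    a′<b : a′ < b
    a′<b = panc⇒< a′≺b

    Va′ : V F a′
    Va′ = anc-Vˡ (proj₁ a′≺b)

    Vb′ : V F b′
    Vb′ = anc-Vʳ ℓ≼b′

    b≼b′ : Anc F b b′
    b≼b′ = anc-trans b≼ℓ ℓ≼b′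

    b<b′ : b < b′
    b<b′ = <-≤-trans b<ℓ (anc⇒≤ ℓ≼b′)

    a′<b′ : a′ < b′
    a′<b′ = <-trans a′<b b<b′

    Va″ : V F a″
    Va″ = proj₁ a″-child

    a′<a″ : a′ < a″
    a′<a″ = child⇒< a″-child

    a″≼b : Anc F a″ b
    a″≼b = child-on-branch⇒anc a″-child a″≼b′ b≼b′ a′<b

    a″≼ℓ : Anc F a″ ℓ
    a″≼ℓ = anc-trans a″≼b b≼ℓ

    a″-onlyB : OnlyB a″
    a″-onlyB = interior-B a″ (between⇒interior (child⇒anc a″-child) a″≼b′ (>⇒≢ a′<a″)
                                 (<⇒≢ (≤-<-trans (anc⇒≤ a″≼b) b<b′)))

    above-a′-onlyA : ∀ {y} → PAnc F y a′ → OnlyA y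
    above-a′-onlyA y≺a′ = spread-down onlyA-closed root-A (λ x → PAnc F x a′) up avoid
                            (anc-root (anc-Vˡ (proj₁ y≺a′))) y≺a′
      where
      up : ∀ {x} → PAnc F x a′ → x ≢ root → PAnc F (parent x) a′
      up x≺a′ x≢r = anc-trans (anc-parent (anc-Vˡ (proj₁ x≺a′))) (proj₁ x≺a′)
                  , <⇒≢ (<-trans (parent-< (anc-Vˡ (proj₁ x≺a′)) x≢r) (panc⇒< x≺a′))
      avoid : ∀ {x} → PAnc F x a′ → x ≢ a′ × x ≢ b′
      avoid x≺a′ = proj₂ x≺a′ , <⇒≢ (<-trans (panc⇒< x≺a′) a′<b′)

    off-branch-onlyB : ∀ {x} → Anc F a″ x → ¬ Anc F b′ x → OnlyB x
    off-branch-onlyB a″≼x b′⋠x = spread-down onlyB-closed a″-onlyB (λ x → Anc F a″ x × ¬ Anc F b′ x) up avoid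
                                   a″≼x (a″≼x , b′⋠x)
      where
      up : ∀ {x} → Anc F a″ x × ¬ Anc F b′ x → x ≢ a″ → Anc F a″ (parent x) × ¬ Anc F b′ (parent x)
      up (a″≼x , b′⋠x) x≢a″ = panc⇒anc-parent (a″≼x , x≢a″ ∘ sym)
                            , λ b′≼px → b′⋠x (anc-trans b′≼px (anc-parent (anc-Vʳ a″≼x)))
      avoid : ∀ {x} → Anc F a″ x × ¬ Anc F b′ x → x ≢ a′ × x ≢ b′
      avoid (a″≼x , b′⋠x) = >⇒≢ (<-≤-trans a′<a″ (anc⇒≤ a″≼x)) , λ { refl → b′⋠x (anc-refl Vb′) }

    below-b′-same-side : ∀ {S : ℕ → Set} → (∀ {x y} → Edge F x y → x ≢ a′ → x ≢ b′ → S y → S x)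
                       → ∀ {c x} → Child F c b′ → S c → Anc F c x → S x
    below-b′-same-side closed {c} c-child sc c≼x = spread-down closed sc (Anc F c) up avoid c≼x c≼x
      where
      up : ∀ {x} → Anc F c x → x ≢ c → Anc F c (parent x)
      up c≼x x≢c = panc⇒anc-parent (c≼x , x≢c ∘ sym)
      avoid : ∀ {x} → Anc F c x → x ≢ a′ × x ≢ b′
      avoid {x} c≼x = >⇒≢ (<-trans a′<b′ b′<x) , >⇒≢ b′<x
        where
        b′<x : b′ < x
        b′<x = <-≤-trans (child⇒< c-child) (anc⇒≤ c≼x)

    child-of-b′-side : ∀ {c} → Child F c b′ → OnlyA c ⊎ OnlyB c
    child-of-b′-side c-child = side (proj₁ c-child) (>⇒≢ (<-trans a′<b′ (child⇒< c-child))) (>⇒≢ (child⇒< c-child))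

    -- an edge from Desc(ℓ) to a vertex of T[a′, b) would leave the B side or hit T(a, b)
    onlyB-back-edge-≥b : ∀ {x y} → Anc F ℓ x → OnlyB x → Edge F x y → Anc F y x → b ≤ y
    onlyB-back-edge-≥b {x} {y} ℓ≼x bx x~y y≼x with anc-comparable y≼x (anc-trans (proj₁ a′≺b) (anc-trans b≼ℓ ℓ≼x))
    ... | inj₁ y≼a′ with y ≟ a′
    ...   | yes refl = contradiction x~y (ℓ↛ab x y ℓ≼x (between⇒interior (proj₁ a≺a′) (proj₁ a′≺b) (>⇒≢ a<a′) (<⇒≢ a′<b)))
    ...   | no y≢a′ = contradiction (edge-sym x~y) (onlyA-onlyB-no-edge (above-a′-onlyA (y≼a′ , y≢a′)) bx)
    onlyB-back-edge-≥b {x} {y} ℓ≼x bx x~y y≼x | inj₂ a′≼y with anc-comparable y≼x (anc-trans b≼ℓ ℓ≼x)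
    ... | inj₂ b≼y = anc⇒≤ b≼y
    ... | inj₁ y≼b with y ≟ b
    ...   | yes refl = ≤-refl
    ...   | no y≢b = contradiction x~y (ℓ↛ab x y ℓ≼x (between⇒interior (anc-trans (proj₁ a≺a′) a′≼y) y≼b
                                                        (>⇒≢ (<-≤-trans a<a′ (anc⇒≤ a′≼y))) y≢b))

    onlyB-back-edge-≥a′ : ∀ {x y} → Anc F a″ x → OnlyB x → Edge F x y → Anc F y x → a′ ≤ y
    onlyB-back-edge-≥a′ {x} {y} a″≼x bx x~y y≼x with anc-comparable y≼x a″≼x
    ... | inj₂ a″≼y = <⇒≤ (<-≤-trans a′<a″ (anc⇒≤ a″≼y))
    ... | inj₁ y≼a″ with y ≟ a″
    ...   | yes refl = <⇒≤ a′<a″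
    ...   | no y≢a″ with y ≟ a′
    ...     | yes refl = ≤-refl
    ...     | no y≢a′ = contradiction (edge-sym x~y)
                          (onlyA-onlyB-no-edge (above-a′-onlyA (anc-child⇒anc-parent a″-child y≼a″ y≢a″ , y≢a′)) bx)

    -- G − a′ is connected, so some edge leaves Desc(a″) towards the root; it must start in Desc(b′)
    exit-edge : Σ ℕ λ x → Σ ℕ λ y → Anc F b′ x × Edge F x y × PAnc F y a′
    exit-edge with walk-exit (Anc? a″) (proj₂ (proj₂ tc) a′ a″ root Va′ Va″ V-root (>⇒≢ a′<a″) (a′≢root ∘ sym))
                             (anc-refl Va″) (proj₁ (proj₂ a″-child) ∘ anc-root⇒root)
    ... | x , y , a″≼x , a″⋠y , x~y , y≢a′ = x , y , b′≼x , x~y , y≺a′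
      where
      y≼x : Anc F y x
      y≼x = [ (λ x≼y → contradiction (anc-trans a″≼x x≼y) a″⋠y) , (λ y≼x → y≼x) ]′ (normal x y x~y)
      y≺a′ : PAnc F y a′
      y≺a′ with anc-comparable y≼x a″≼x
      ... | inj₂ a″≼y = contradiction a″≼y a″⋠y
      ... | inj₁ y≼a″ = anc-child⇒anc-parent a″-child y≼a″ (λ { refl → a″⋠y (anc-refl Va″) }) , y≢a′
      b′≼x : Anc F b′ x
      b′≼x with Anc? b′ x
      ... | yes b′≼x = b′≼x
      ... | no b′⋠x = contradiction (edge-sym x~y) (onlyA-onlyB-no-edge (above-a′-onlyA y≺a′) (off-branch-onlyB a″≼x b′⋠x))

    exit-in-L : ∀ {z} → Anc F a″ z → Anc F z b′ → Σ ℕ λ y → InL F z y × y < a′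
    exit-in-L {z} a″≼z z≼b′ with exit-edge
    ... | x , y , b′≼x , x~y , y≺a′ =
      y , ((y≼z , <⇒≢ (<-≤-trans y<a′ (<⇒≤ (<-≤-trans a′<a″ (anc⇒≤ a″≼z))))) , x , anc-trans z≼b′ b′≼x , x~y) , y<a′
      where
      y<a′ : y < a′
      y<a′ = panc⇒< y≺a′
      y≼z : Anc F y z
      y≼z = anc-trans (proj₁ y≺a′) (anc-trans (child⇒anc a″-child) a″≼z)

    lwpt₁-off-branch-≥ : ∀ {c w} → Anc F a″ c → (∀ {x} → Anc F c x → ¬ Anc F b′ x) → Lwpt1 F c w → a′ ≤ w
    lwpt₁-off-branch-≥ a″≼c _ (inj₂ (_ , refl)) = <⇒≤ (<-≤-trans a′<a″ (anc⇒≤ a″≼c))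
    lwpt₁-off-branch-≥ a″≼c off (inj₁ (((w≼c , _) , x , c≼x , x~w) , _)) =
      onlyB-back-edge-≥a′ a″≼x (off-branch-onlyB a″≼x (off c≼x)) x~w (anc-trans w≼c c≼x)
      where
      a″≼x : Anc F a″ x
      a″≼x = anc-trans a″≼c c≼x

    -- a sibling w′ > z of z would have lwpt₁(w′) ≥ a′ > lwpt₁(z), against the compatible numbering
    branch-leftChild : ∀ {z} → Anc F a″ z → Anc F z b′ → z ≢ a″ → LeftChild F (parent z) z
    branch-leftChild {z} a″≼z z≼b′ z≢a″ with leftChild-exists (panc⇒child (a″≼z , z≢a″ ∘ sym))
    ... | w′ , w′-left with z ≟ w′
    ...   | yes refl = w′-left
    ...   | no z≢w′ = contradiction (sibling-lwpt₁-≤ z-child w′-child z<w′ (proj₂ lw-z) (proj₂ lw-w′))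
                                    (<⇒≱ (<-≤-trans lw-z<a′ a′≤lw-w′))
      where
      a″≺z : PAnc F a″ z
      a″≺z = a″≼z , z≢a″ ∘ sym
      z-child : Child F z (parent z)
      z-child = panc⇒child a″≺z
      w′-child : Child F w′ (parent z)
      w′-child = proj₁ w′-left
      z<w′ : z < w′
      z<w′ = ≤∧≢⇒< (proj₂ w′-left z z-child) z≢w′
      lw-z : ∃ (Lwpt1 F z)
      lw-z = lwpt₁-exists z
      lw-w′ : ∃ (Lwpt1 F w′)
      lw-w′ = lwpt₁-exists w′
      lw-z<a′ : proj₁ lw-z < a′
      lw-z<a′ = let y , y∈L , y<a′ = exit-in-L a″≼z z≼b′ in ≤-<-trans (lwpt₁-≤ (proj₂ lw-z) y∈L) y<a′
      a′≤lw-w′ : a′ ≤ proj₁ lw-w′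
      a′≤lw-w′ = lwpt₁-off-branch-≥ (anc-trans (panc⇒anc-parent a″≺z) (child⇒anc w′-child))
                   (λ w′≼x b′≼x → z≢w′ (child-towards-unique z-child w′-child (anc-trans z≼b′ b′≼x) w′≼x))
                   (proj₂ lw-w′)

    branch-leftmost : ∀ {u z} → Anc F a″ u → Anc F u z → Anc F z b′ → LeftmostDesc F u z
    branch-leftmost {u} a″≼u (vz , k , e) = go k vz e
      where
      go : ∀ k {z} → V F z → iter parent k z ≡ u → Anc F z b′ → LeftmostDesc F u z
      go zero _ refl _ = lm-refl
      go (suc k) {z} vz e z≼b′ with z ≟ u
      ... | yes refl = lm-refl
      ... | no z≢u = lm-step (go k (V-parent vz) (trans (iter-parent-comm k z) e) (anc-trans (anc-parent vz) z≼b′))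
                             (branch-leftChild (anc-trans a″≼u u≼z) z≼b′ z≢a″)
        where
        u≼z : Anc F u z
        u≼z = vz , suc k , e
        z≢a″ : z ≢ a″
        z≢a″ refl = z≢u (sym (anc-antisym u≼z a″≼u))

    a″⇝ℓ : LeftmostDesc F a″ ℓ
    a″⇝ℓ = branch-leftmost (anc-refl Va″) a″≼ℓ ℓ≼b′

    ℓ⇝b′ : LeftmostDesc F ℓ b′
    ℓ⇝b′ = branch-leftmost a″≼ℓ ℓ≼b′ (anc-refl Vb′)

    a′⇝ℓ-stable : Stable F a′ ℓ
    a′⇝ℓ-stable = a″ , a″-child , a″⇝ℓ , stable
      where
      stable : ∀ x y → BackEdge F x y → a″ ≤ x → x < ℓ → a′ ≤ y
      stable x y (x~y , y≺x) a″≤x x<ℓ with before-leftmost⇒outside Va″ a″⇝ℓ a″≤x x<ℓ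
      ... | a″≼x , ℓ⋠x = onlyB-back-edge-≥a′ a″≼x (off-branch-onlyB a″≼x (ℓ⋠x ∘ anc-trans ℓ≼b′)) x~y (proj₁ y≺x)

    α-facts : Anc F α (parent b) × Stable F α ℓ × a′ ≤ α
    α-facts with α-stab
    ... | inj₁ (α≼pb , α⇝ℓ , max) = α≼pb , α⇝ℓ , max a′ (panc⇒anc-parent a′≺b) a′⇝ℓ-stable
    ... | inj₂ (none , _) = contradiction a′⇝ℓ-stable (none a′ (panc⇒anc-parent a′≺b))

    a<α : a < α
    a<α = <-≤-trans a<a′ (proj₂ (proj₂ α-facts))

    α<b : α < b
    α<b = ≤-<-trans (anc⇒≤ (proj₁ α-facts)) (parent-< (anc-Vˡ b≼ℓ) b≢root)

    a′≼b′ : Anc F a′ b′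
    a′≼b′ = anc-trans (proj₁ a′≺b) b≼b′

    -- T(a′, b′) lies on the B side and T(a, b) has no neighbour in Desc(ℓ)
    onlyA-edge-to-branch-≤a : ∀ {x y} → Anc F ℓ x → OnlyA x → Edge F x y → Anc F y b′ → y ≢ b′ → y ≤ a
    onlyA-edge-to-branch-≤a {x} {y} ℓ≼x ax x~y y≼b′ y≢b′ with Anc? b y
    ... | yes b≼y = contradiction x~y (onlyA-onlyB-no-edge ax (interior-B y
                      (between⇒interior (anc-trans (proj₁ a′≺b) b≼y) y≼b′ (>⇒≢ (<-≤-trans a′<b (anc⇒≤ b≼y))) y≢b′)))
    ... | no b⋠y with anc-comparable y≼b′ (anc-trans (proj₁ a≺a′) a′≼b′)
    ...   | inj₁ y≼a = anc⇒≤ y≼a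
    ...   | inj₂ a≼y with y ≟ a
    ...     | yes refl = ≤-refl
    ...     | no y≢a = contradiction x~y (ℓ↛ab x y ℓ≼x (between⇒interior a≼y y≼b y≢a λ { refl → b⋠y (anc-refl (anc-Vˡ b≼ℓ)) }))
      where
      y≼b : Anc F y b
      y≼b = [ (λ y≼b → y≼b) , (λ b≼y → contradiction b≼y b⋠y) ]′ (anc-comparable y≼b′ b≼b′)

    onlyB-subtree-lwpt₁-≥b : ∀ {c w} → Anc F ℓ c → (∀ {x} → Anc F c x → OnlyB x) → Lwpt1 F c w → b ≤ w
    onlyB-subtree-lwpt₁-≥b ℓ≼c _ (inj₂ (_ , refl)) = <⇒≤ (<-≤-trans b<ℓ (anc⇒≤ ℓ≼c))
    onlyB-subtree-lwpt₁-≥b ℓ≼c all-B (inj₁ (((w≼c , _) , x , c≼x , x~w) , _)) =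
      onlyB-back-edge-≥b (anc-trans ℓ≼c c≼x) (all-B c≼x) x~w (anc-trans w≼c c≼x)

    child-of-b′-condition : ∀ {c w h} → Child F c b′ → Lwpt1 F c w → Hgpt F c h → b ≤ w ⊎ h ≤ a
    child-of-b′-condition {c} {w} c-child lw hg with child-of-b′-side c-child
    ... | inj₂ bc = inj₁ (onlyB-subtree-lwpt₁-≥b (anc-trans ℓ≼b′ (child⇒anc c-child))
                                                 (below-b′-same-side onlyB-closed c-child bc) lw)
    ... | inj₁ ac with hg
    ...   | inj₁ ((((h≼c , h≢c) , x , c≼x , x~h) , h≢pc) , _) =
            inj₂ (onlyA-edge-to-branch-≤a (anc-trans ℓ≼b′ (anc-trans (child⇒anc c-child) c≼x))
                    (below-b′-same-side onlyA-closed c-child ac c≼x) x~h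
                    (anc-child⇒anc-parent c-child h≼c h≢c) (λ h≡b′ → h≢pc (trans h≡b′ (sym (proj₂ (proj₂ c-child))))))
    ...   | inj₂ (none , _) with lw
    ...     | inj₂ (_ , refl) = inj₁ (<⇒≤ (<-trans b<b′ (child⇒< c-child)))
    ...     | inj₁ (w∈L , _) with w ≟ parent c
    ...       | yes refl = inj₁ (subst (b ≤_) (sym (proj₂ (proj₂ c-child))) (<⇒≤ b<b′))
    ...       | no w≢pc = contradiction (w∈L , w≢pc) (none _)

    b′-betaCond : BetaCond F b b′
    b′-betaCond with bounded-∃? (λ c → Child? c b′) n (λ _ c-child → proj₂ (proj₁ c-child))
    ... | no none = inj₁ (λ c c-child → none (c , c-child))
    ... | yes (_ , c-child) with leftChild-exists c-child
    ...   | ℓ′ , ℓ′-left with lwpt₁-exists ℓ′ | hgpt-exists ℓ′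
    ...     | w , lw | h , hg = inj₂ (ℓ′ , ℓ′-left , w , h , lw , hg ,
                                      map₂ (λ h≤a → ≤-<-trans h≤a a<b) (child-of-b′-condition (proj₁ ℓ′-left) lw hg))

    β≼b′ : Anc F β b′
    β≼b′ = leftmost-≤⇒anc Vℓ ℓ⇝β ℓ⇝b′ (proj₂ (proj₂ β-spec) b′ ℓ⇝b′ b′-betaCond)

    α⇝β-stable : Stable F α β
    α⇝β-stable with proj₁ (proj₂ α-facts)
    ... | α″ , α″-child , α″⇝ℓ , stable-ℓ = α″ , α″-child , leftmost-trans α″⇝ℓ ℓ⇝β , stable-β
      where
      stable-β : ∀ x y → BackEdge F x y → α″ ≤ x → x < β → α ≤ y
      stable-β x y y-back α″≤x x<β with x <? ℓ
      ... | yes x<ℓ = stable-ℓ x y y-back α″≤x x<ℓ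
      ... | no x≮ℓ with before-leftmost⇒outside Vℓ ℓ⇝β (≮⇒≥ x≮ℓ) x<β
      ...   | ℓ≼x , β⋠x = <⇒≤ (<-≤-trans α<b (onlyB-back-edge-≥b ℓ≼x
                            (off-branch-onlyB (anc-trans a″≼ℓ ℓ≼x) (β⋠x ∘ anc-trans β≼b′))
                            (proj₁ y-back) (proj₁ (proj₂ y-back))))

    ≥b-or-≤a⇒condition : ∀ {w h} → b ≤ w ⊎ h ≤ a → α ≤ w ⊎ h ≤ α
    ≥b-or-≤a⇒condition = map (≤-trans (<⇒≤ α<b)) (λ h≤a → ≤-trans h≤a (<⇒≤ a<α))

    β-child-off-branch : β ≢ b′ → ∀ {c x} → Child F c β → ¬ LeftChild F β c → Anc F c x → ¬ Anc F b′ x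
    β-child-off-branch β≢b′ {c} c-child not-left c≼x b′≼x with Anc? c b′
    ... | yes c≼b′ = not-left (subst (λ u → LeftChild F u c) (proj₂ (proj₂ c-child))
                       (branch-leftChild (anc-trans a″≼ℓ (anc-trans ℓ≼β (child⇒anc c-child))) c≼b′
                         (>⇒≢ (≤-<-trans (anc⇒≤ a″≼b) (<-trans b<β (child⇒< c-child))))))
    ... | no c⋠b′ with anc-comparable c≼x b′≼x
    ...   | inj₁ c≼b′ = c⋠b′ c≼b′
    ...   | inj₂ b′≼c = β≢b′ (anc-antisym β≼b′ (anc-child⇒anc-parent c-child b′≼c λ { refl → c⋠b′ (anc-refl Vb′) }))

    children-condition : ChildrenCondition
    children-condition c c-child w h lw hg with β ≟ b′
    ... | yes β≡b′ = ≥b-or-≤a⇒condition (child-of-b′-condition (subst (Child F c) β≡b′ c-child) lw hg)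
    ... | no β≢b′ with proj₁ (proj₂ β-spec)
    ...   | inj₁ β-leaf = let c′ , c′-child , _ = child-towards β≼b′ β≢b′ in contradiction c′-child (β-leaf c′)
    ...   | inj₂ (ℓ′ , ℓ′-left , w′ , h′ , lw′ , hg′ , ≥b-or-<b) with c ≟ ℓ′
    ...     | yes refl rewrite minOrSelf-unique lw lw′ | maxOrSelf-unique hg hg′ =
              ≥b-or-≤a⇒condition (map₂ (low-hgpt (anc-trans ℓ≼β (child⇒anc c-child)) hg′) ≥b-or-<b)
    ...     | no c≢ℓ′ = inj₁ (≤-trans (<⇒≤ α<b) (onlyB-subtree-lwpt₁-≥b ℓ≼c
                          (λ c≼x → off-branch-onlyB (anc-trans a″≼ℓ (anc-trans ℓ≼c c≼x))
                                     (β-child-off-branch β≢b′ c-child (λ c-left → c≢ℓ′ (leftChild-unique c-left ℓ′-left)) c≼x))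
                          lw))
      where
      ℓ≼c : Anc F ℓ c
      ℓ≼c = anc-trans ℓ≼β (child⇒anc c-child)

    result : a < α × ChildrenCondition × Stable F α β
    result = a<α , children-condition , α⇝β-stable

  module Backward (a<α : a < α) (condition : ChildrenCondition) {α″ : ℕ} (α″-child : Child F α″ α)
                  (α″⇝β : LeftmostDesc F α″ β) (stable : ∀ x y → BackEdge F x y → α″ ≤ x → x < β → α ≤ y) where

    α≼pb : Anc F α (parent b)
    α≼pb with α-stab
    ... | inj₁ (α≼pb , _) = α≼pb
    ... | inj₂ (_ , refl) = contradiction a<α λ ()

    α≼b : Anc F α b
    α≼b = anc-trans α≼pb (anc-parent (anc-Vˡ b≼ℓ))

    α<b : α < b
    α<b = ≤-<-trans (anc⇒≤ α≼pb) (parent-< (anc-Vˡ b≼ℓ) b≢root)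

    Vα″ : V F α″
    Vα″ = proj₁ α″-child

    Vβ : V F β
    Vβ = anc-Vʳ ℓ≼β

    α<α″ : α < α″
    α<α″ = child⇒< α″-child

    α″≼β : Anc F α″ β
    α″≼β = leftmost⇒anc Vα″ α″⇝β

    α≼β : Anc F α β
    α≼β = anc-trans (child⇒anc α″-child) α″≼β

    α<β : α < β
    α<β = <-≤-trans α<α″ (anc⇒≤ α″≼β)

    a≺α : PAnc F a α
    a≺α = [ (λ a≼α → a≼α) , (λ α≼a → contradiction (anc⇒≤ α≼a) (<⇒≱ a<α)) ]′ (anc-comparable (proj₁ a≺b) α≼b)
        , <⇒≢ a<α

    EdgeIntoGap : ℕ → Set
    EdgeIntoGap c = Σ ℕ λ x → Σ ℕ λ y → Anc F c x × Edge F x y × α < y × y < β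

    -- the B side of the separation, without its separator {α, β}
    BSide : ℕ → Set
    BSide v = (Anc F α″ v × ¬ Anc F β v) ⊎ Σ ℕ λ c → Child F c β × Anc F c v × EdgeIntoGap c

    EdgeIntoGap? : Decidable EdgeIntoGap
    EdgeIntoGap? c = bounded-∃? (λ x → bounded-∃? (λ y → Anc? c x ×-dec (Edge? F x y ×-dec (α <? y ×-dec y <? β)))
                                                  n (λ _ (_ , _ , _ , y<β) → ≤-trans (<⇒≤ y<β) (proj₂ Vβ)))
                                n (λ _ (_ , c≼x , _) → proj₂ (anc-Vʳ c≼x))

    BSide? : Decidable BSide
    BSide? v = (Anc? α″ v ×-dec ¬? (Anc? β v))
         ⊎-dec bounded-∃? (λ c → Child? c β ×-dec (Anc? c v ×-dec EdgeIntoGap? c)) n (λ _ (c-child , _) → proj₂ (proj₁ c-child))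

    BSide⊆V : ∀ {v} → BSide v → V F v
    BSide⊆V (inj₁ (α″≼v , _)) = anc-Vʳ α″≼v
    BSide⊆V (inj₂ (_ , _ , c≼v , _)) = anc-Vʳ c≼v

    α∉BSide : ¬ BSide α
    α∉BSide (inj₁ (α″≼α , _)) = <⇒≱ α<α″ (anc⇒≤ α″≼α)
    α∉BSide (inj₂ (c , c-child , c≼α , _)) = <⇒≱ (<-trans α<β (child⇒< c-child)) (anc⇒≤ c≼α)

    β∉BSide : ¬ BSide β
    β∉BSide (inj₁ (_ , β⋠β)) = β⋠β (anc-refl Vβ)
    β∉BSide (inj₂ (c , c-child , c≼β , _)) = <⇒≱ (child⇒< c-child) (anc⇒≤ c≼β)

    root∉BSide : ¬ BSide root
    root∉BSide (inj₁ (α″≼r , _)) = proj₁ (proj₂ α″-child) (anc-root⇒root α″≼r)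
    root∉BSide (inj₂ (c , c-child , c≼r , _)) = proj₁ (proj₂ c-child) (anc-root⇒root c≼r)

    interior⊆BSide : ∀ v → Interior F α β v → BSide v
    interior⊆BSide v v-int with interior⇒between α≼β v-int
    ... | α≼v , v≼β with child-towards α≼v (proj₁ (proj₂ v-int) ∘ sym)
    ...   | c , c-child , c≼v with child-towards-unique c-child α″-child (anc-trans c≼v v≼β) α″≼β
    ...     | refl = inj₁ (c≼v , λ β≼v → proj₂ (proj₂ v-int) (anc-antisym v≼β β≼v))

    b-interior : Interior F α β b
    b-interior = between⇒interior α≼b b≼β (>⇒≢ α<b) (<⇒≢ b<β)

    -- such an edge puts x into L(c) below α and the gap vertex y into L(c) above α
    gap-child-no-low-edge : ∀ {c x} → Child F c β → EdgeIntoGap c → InL F c x → x < α → ⊥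
    gap-child-no-low-edge {c} c-child (x₀ , y , c≼x₀ , x₀~y , α<y , y<β) x∈L x<α
      with condition c c-child _ _ (proj₂ (lwpt₁-exists c)) (proj₂ (hgpt-exists c))
    ... | inj₁ α≤w = <⇒≱ x<α (≤-trans α≤w (lwpt₁-≤ (proj₂ (lwpt₁-exists c)) x∈L))
    ... | inj₂ h≤α = <⇒≱ α<y (≤-trans (hgpt-≥ (proj₂ (hgpt-exists c)) y∈L y≢pc) h≤α)
      where
      y<c : y < c
      y<c = <-trans y<β (child⇒< c-child)
      y∈L : InL F c y
      y∈L = (edge-leaving-subtree c≼x₀ x₀~y y<c , <⇒≢ y<c) , x₀ , c≼x₀ , x₀~y
      y≢pc : y ≢ parent c
      y≢pc y≡pc = <⇒≢ y<β (trans y≡pc (proj₂ (proj₂ c-child)))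

    above-α″⇒<α : ∀ {x} → Anc F x α″ → x ≢ α″ → x ≢ α → x < α
    above-α″⇒<α x≼α″ x≢α″ x≢α = ≤∧≢⇒< (anc⇒≤ (anc-child⇒anc-parent α″-child x≼α″ x≢α″)) x≢α

    no-edge-into-branch : ∀ {x y} → ¬ BSide x → x ≢ α → x ≢ β → Anc F α″ y → ¬ Anc F β y → ¬ Edge F x y
    no-edge-into-branch {x} {y} x∉ x≢α x≢β α″≼y β⋠y x~y with normal x y x~y
    ... | inj₁ x≼y with anc-comparable x≼y α″≼y
    ...   | inj₂ α″≼x = x∉ (inj₁ (α″≼x , λ β≼x → β⋠y (anc-trans β≼x x≼y)))
    ...   | inj₁ x≼α″ with x ≟ α″
    ...     | yes refl = x∉ (inj₁ (anc-refl Vα″ , λ β≼x → β⋠y (anc-trans β≼x x≼y)))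
    ...     | no x≢α″ = <⇒≱ (above-α″⇒<α x≼α″ x≢α″ x≢α)
                          (stable y x (edge-sym x~y , x≼y , λ { refl → x∉ (inj₁ (α″≼y , β⋠y)) })
                                  (anc⇒≤ α″≼y) (leftmost-outside⇒< α″⇝β α″≼y β⋠y))
    no-edge-into-branch {x} {y} x∉ x≢α x≢β α″≼y β⋠y x~y | inj₂ y≼x with Anc? β x
    ... | no β⋠x = x∉ (inj₁ (anc-trans α″≼y y≼x , β⋠x))
    ... | yes β≼x with child-towards β≼x (x≢β ∘ sym)
    ...   | c , c-child , c≼x =
            x∉ (inj₂ (c , c-child , c≼x , x , y , c≼x , x~y
                     , <-≤-trans α<α″ (anc⇒≤ α″≼y) , leftmost-outside⇒< α″⇝β α″≼y β⋠y))

    no-edge-into-gap-child : ∀ {x y c} → ¬ BSide x → x ≢ α → x ≢ β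
                           → Child F c β → Anc F c y → EdgeIntoGap c → ¬ Edge F x y
    no-edge-into-gap-child {x} {y} {c} x∉ x≢α x≢β c-child c≼y gap x~y with normal x y x~y
    ... | inj₂ y≼x = x∉ (inj₂ (c , c-child , anc-trans c≼y y≼x , gap))
    ... | inj₁ x≼y with anc-comparable x≼y c≼y
    ...   | inj₂ c≼x = x∉ (inj₂ (c , c-child , c≼x , gap))
    ...   | inj₁ x≼c with x ≟ c
    ...     | yes refl = x∉ (inj₂ (x , c-child , anc-refl (proj₁ c-child) , gap))
    ...     | no x≢c with anc-child⇒anc-parent c-child x≼c x≢c
    ...       | x≼β with anc-comparable x≼β α″≼β
    ...         | inj₂ α″≼x = x∉ (inj₁ (α″≼x , λ β≼x → x≢β (anc-antisym x≼β β≼x)))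
    ...         | inj₁ x≼α″ with x ≟ α″
    ...           | yes refl = x∉ (inj₁ (anc-refl Vα″ , λ β≼x → x≢β (anc-antisym x≼β β≼x)))
    ...           | no x≢α″ = gap-child-no-low-edge c-child gap ((x≼c , x≢c) , y , c≼y , edge-sym x~y)
                                                    (above-α″⇒<α x≼α″ x≢α″ x≢α)

    no-edge-into-BSide : ∀ x y → ¬ BSide x → x ≢ α → x ≢ β → BSide y → ¬ Edge F x y
    no-edge-into-BSide x y x∉ x≢α x≢β (inj₁ (α″≼y , β⋠y)) = no-edge-into-branch x∉ x≢α x≢β α″≼y β⋠y
    no-edge-into-BSide x y x∉ x≢α x≢β (inj₂ (c , c-child , c≼y , gap)) = no-edge-into-gap-child x∉ x≢α x≢β c-child c≼y gap

    open SideSeparation {F} V-root BSide? BSide⊆V (anc-Vˡ α≼b) Vβ α∉BSide β∉BSide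

    result : Type2Below
    result = α , β , A , B , a≺α , (α≼b , <⇒≢ α<b) , child⇒panc ℓ-child , ℓ≼β
           , type2 (<⇒≢ α<β) (panc⇒≢root a≺α) (panc⇒≢root (α≼β , <⇒≢ α<β)) root∉BSide
                   no-edge-into-BSide (b , b-interior) interior⊆BSide

  forward : Type2Below → a < α × ChildrenCondition × Stable F α β
  forward (a′ , b′ , _ , _ , a≺a′ , a′≺b , _ , ℓ≼b′ , type2) =
    Forward.result (type2⇒rootSide sg type2) a≺a′ a′≺b ℓ≼b′ (proj₁ (proj₂ (proj₂ type2)))
                   (proj₁ (proj₂ towards-b′)) (proj₂ (proj₂ towards-b′))
    where
    a′≺b′ : PAnc F a′ b′
    a′≺b′ = anc-trans (proj₁ a′≺b) (anc-trans b≼ℓ ℓ≼b′) , <⇒≢ (<-trans (panc⇒< a′≺b) (<-≤-trans b<ℓ (anc⇒≤ ℓ≼b′)))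
    towards-b′ : Σ ℕ λ c → Child F c a′ × Anc F c b′
    towards-b′ = child-towards (proj₁ a′≺b′) (proj₂ a′≺b′)

  backward : a < α × ChildrenCondition × Stable F α β → Type2Below
  backward (a<α , condition , α″ , α″-child , α″⇝β , stable) = Backward.result a<α condition α″-child α″⇝β stable

lemma5p3 : (F : Frame) → SimpleGraph F → TwoConnected F
    → RootedSpanningTree F → Normal F → Compatible F
    → ∀ a b → PAnc F a b → ¬ Leaf F b
    → ∀ ℓ → LeftChild F b ℓ
    → (∀ x y → Anc F ℓ x → Interior F a b y → ¬ Edge F x y)
    → ∀ α β → IsAlpha F b α → IsBeta F b β
    → (Σ ℕ (λ a' → Σ ℕ (λ b' → Σ (ℕ → Bool) (λ A → Σ (ℕ → Bool) (λ B →
          PAnc F a a' × PAnc F a' b × PAnc F b ℓ × Anc F ℓ b' × Type2 F A B a' b')))))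
      ⇔ (a < α
         × (∀ c → Child F c β → ∀ w h → Lwpt1 F c w → Hgpt F c h → α ≤ w ⊎ h ≤ α)
         × Stable F α β)
lemma5p3 F sg tc rst normal cmp a b a≺b b-inner ℓ ℓ-left ℓ↛ab α β α-def β-def = mk⇔ forward backward
  where open Setting F sg tc rst normal cmp a≺b b-inner ℓ-left ℓ↛ab α-def β-def
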